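{- For any two points $a,b\in\mathbb{R}^2$ and any four points $p_1,\dots,p_4$ in general position in the plane, $$\sum_{1\le i<j\le4}w_{ij}f_{ij}=1,$$ where $f_{ij}=\det(a,p_i,p_j)\det(b,p_i,p_j)$ and $w_{ij}=\dfrac{1}{\det(p_i,p_j,p_k)\det(p_i,p_j,p_l)}$ with $\{k,l\}=\{1,2,3,4\}\setminus\{i,j\}$.
   Context: $\det(q_0,q_1,q_2)$ denotes the determinant of the $3\times3$ matrix with columns $(q_0,1),(q_1,1),(q_2,1)$. General position: no three collinear. -}

module Defs where

open import Level using (_⊔_)
open import Algebra.Bundles using (CommutativeRing)
open import Data.Product using (_×_; _,_; Σ)
open import Relation.Nullary using (¬_)

IsField : ∀ {c ℓ} → CommutativeRing c ℓ → Set (c ⊔ ℓ)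
IsField R = ¬ (0# ≈ 1#) × (∀ x → ¬ (x ≈ 0#) → Σ Carrier λ y → x * y ≈ 1#)
  where open CommutativeRing R

module Plane {c ℓ} (R : CommutativeRing c ℓ) where
  open CommutativeRing R

  Point : Set c
  Point = Carrier × Carrier

  -- det(q0,q1,q2) = determinant of the 3×3 matrix with columns
  -- (q0,1),(q1,1),(q2,1), i.e. rows (x0 x1 x2),(y0 y1 y2),(1 1 1),
  -- expanded along the first row.
  det : Point → Point → Point → Carrier
  det (x0 , y0) (x1 , y1) (x2 , y2) =
    x0 * (y1 - y2) - x1 * (y0 - y2) + x2 * (y0 - y1)

  Collinear : Point → Point → Point → Set ℓ
  Collinear q0 q1 q2 = det q0 q1 q2 ≈ 0#

  GeneralPosition4 : Point → Point → Point → Point → Set ℓ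
  GeneralPosition4 p1 p2 p3 p4 =
    ¬ Collinear p1 p2 p3 × ¬ Collinear p1 p2 p4 ×
    ¬ Collinear p1 p3 p4 × ¬ Collinear p2 p3 p4

  f : Point → Point → Point → Point → Carrier
  f a b pi pj = det a pi pj * det b pi pj

  IsWeight : Carrier → Point → Point → Point → Point → Set ℓ
  IsWeight w pi pj pk pl = w * (det pi pj pk * det pi pj pl) ≈ 1#

{-# OPTIONS --safe #-}
module Submission where

open import Defs
open import Algebra.Bundles using (CommutativeRing)
open import Algebra.Solver.Ring.AlmostCommutativeRing
  using (fromCommutativeRing; _-Raw-AlmostCommutative⟶_)
open import Data.Integer.Base as ℤ using (ℤ; +_; -[1+_]; _⊖_; _◃_; sign; ∣_∣)
import Data.Integer.Properties as ℤ
open import Data.Maybe.Base using (Maybe; just; nothing)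
open import Data.Nat.Base as ℕ using (ℕ; zero; suc)
import Data.Nat.Properties as ℕ
open import Data.Product using (_,_; proj₁; proj₂)
open import Data.Sign.Base as Sign using (Sign)
import Relation.Binary.PropositionalEquality.Core as ≡
open import Relation.Nullary.Decidable.Core using (yes; no)

-- Let Π be the product of the four triangle determinants det(p_i,p_j,p_k);
-- it is symmetric in p1,…,p4 and nonzero by general position. As w_ij inverts
-- det(p_i,p_j,p_k) det(p_i,p_j,p_l), the product w_ij Π is the polynomial
-- det(p_i,p_k,p_l) det(p_j,p_k,p_l), that is f_kl evaluated at (p_i,p_j).
-- Multiplied by Π, the claim thus becomes the polynomial identity
-- Σ f_kl(p_i,p_j) f_ij(a,b) = Π, valid in every commutative ring: both sides
-- are bilinear in (a,1) and (b,1), and they agree when a and b are vertices of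
-- the triangle p1 p2 p3.

-- The ring solver can only see cancellations among coefficients whose equality
-- it decides, so an abstract ring cannot serve as its own coefficient ring (as
-- it does in Tactic.RingSolver); we use ℤ and the canonical homomorphism ℤ → R.
module IntegerCoefficients {c ℓ} (R : CommutativeRing c ℓ) where
  open CommutativeRing R
  open import Algebra.Properties.Ring ring
  open import Algebra.Properties.Semiring.Mult semiring using (_×_; ×-homo-+; ×1-homo-*)
  open import Algebra.Properties.CommutativeSemigroup *-commutativeSemigroup using (interchange)
  open import Relation.Binary.Reasoning.Setoid setoid

  ⟦_⟧ℤ : ℤ → Carrier
  ⟦ + n ⟧ℤ      = n × 1#
  ⟦ -[1+ n ] ⟧ℤ = - (suc n × 1#)

  private
    1+x-[1+y]≈x-y : ∀ x y → (1# + x) - (1# + y) ≈ x - y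
    1+x-[1+y]≈x-y x y = begin
      (1# + x) + - (1# + y)   ≈⟨ +-cong (+-comm x 1#) (-‿+-comm 1# y) ⟨
      (x + 1#) + (- 1# + - y) ≈⟨ +-assoc x 1# _ ⟩
      x + (1# + (- 1# + - y)) ≈⟨ +-congˡ (+-assoc 1# (- 1#) (- y)) ⟨
      x + ((1# + - 1#) + - y) ≈⟨ +-congˡ (+-congʳ (-‿inverseʳ 1#)) ⟩
      x + (0# + - y)          ≈⟨ +-congˡ (+-identityˡ (- y)) ⟩
      x - y                   ∎

    ⊖-homo : ∀ m n → ⟦ m ⊖ n ⟧ℤ ≈ m × 1# - n × 1#
    ⊖-homo m       zero    = sym (trans (+-congˡ -0#≈0#) (+-identityʳ (m × 1#)))
    ⊖-homo zero    (suc n) = sym (+-identityˡ _)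
    ⊖-homo (suc m) (suc n) = begin
      ⟦ suc m ⊖ suc n ⟧ℤ    ≡⟨ ≡.cong ⟦_⟧ℤ (ℤ.[1+m]⊖[1+n]≡m⊖n m n) ⟩
      ⟦ m ⊖ n ⟧ℤ            ≈⟨ ⊖-homo m n ⟩
      m × 1# - n × 1#       ≈⟨ 1+x-[1+y]≈x-y _ _ ⟨
      suc m × 1# - suc n × 1# ∎

    +-homo : ∀ i j → ⟦ i ℤ.+ j ⟧ℤ ≈ ⟦ i ⟧ℤ + ⟦ j ⟧ℤ
    +-homo (+ m)    (+ n)    = ×-homo-+ 1# m n
    +-homo (+ m)    -[1+ n ] = ⊖-homo m (suc n)
    +-homo -[1+ m ] (+ n)    = trans (⊖-homo n (suc m)) (+-comm _ _)
    +-homo -[1+ m ] -[1+ n ] = begin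
      - (suc (suc (m ℕ.+ n)) × 1#)          ≡⟨ ≡.cong (λ k → - (suc k × 1#)) (ℕ.+-suc m n) ⟨
      - ((suc m ℕ.+ suc n) × 1#)            ≈⟨ -‿cong (×-homo-+ 1# (suc m) (suc n)) ⟩
      - (suc m × 1# + suc n × 1#)           ≈⟨ -‿+-comm _ _ ⟨
      - (suc m × 1#) + - (suc n × 1#)       ∎

    σ : Sign → Carrier
    σ Sign.+ = 1#
    σ Sign.- = - 1#

    σ-homo : ∀ s t → σ (s Sign.* t) ≈ σ s * σ t
    σ-homo Sign.+ t      = sym (*-identityˡ (σ t))
    σ-homo Sign.- Sign.+ = sym (*-identityʳ (- 1#))
    σ-homo Sign.- Sign.- = begin
      1#          ≈⟨ -‿involutive 1# ⟨
      - - 1#      ≈⟨ -1*x≈-x (- 1#) ⟨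
      - 1# * - 1# ∎

    ◃-homo : ∀ s n → ⟦ s ◃ n ⟧ℤ ≈ σ s * (n × 1#)
    ◃-homo s      zero    = sym (zeroʳ (σ s))
    ◃-homo Sign.+ (suc n) = sym (*-identityˡ _)
    ◃-homo Sign.- (suc n) = sym (-1*x≈-x _)

    sign-abs : ∀ i → ⟦ i ⟧ℤ ≈ σ (sign i) * (∣ i ∣ × 1#)
    sign-abs i =
      trans (reflexive (≡.cong ⟦_⟧ℤ (≡.sym (ℤ.◃-inverse i)))) (◃-homo (sign i) ∣ i ∣)

    *-homo : ∀ i j → ⟦ i ℤ.* j ⟧ℤ ≈ ⟦ i ⟧ℤ * ⟦ j ⟧ℤ
    *-homo i j = begin
      ⟦ (sign i Sign.* sign j) ◃ (∣ i ∣ ℕ.* ∣ j ∣) ⟧ℤ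
        ≈⟨ ◃-homo (sign i Sign.* sign j) (∣ i ∣ ℕ.* ∣ j ∣) ⟩
      σ (sign i Sign.* sign j) * ((∣ i ∣ ℕ.* ∣ j ∣) × 1#)
        ≈⟨ *-cong (σ-homo (sign i) (sign j)) (×1-homo-* ∣ i ∣ ∣ j ∣) ⟩
      (σ (sign i) * σ (sign j)) * (∣ i ∣ × 1# * ∣ j ∣ × 1#)
        ≈⟨ interchange _ _ _ _ ⟩
      (σ (sign i) * ∣ i ∣ × 1#) * (σ (sign j) * ∣ j ∣ × 1#)
        ≈⟨ *-cong (sign-abs i) (sign-abs j) ⟨
      ⟦ i ⟧ℤ * ⟦ j ⟧ℤ
        ∎

    -‿homo : ∀ i → ⟦ ℤ.- i ⟧ℤ ≈ - ⟦ i ⟧ℤ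
    -‿homo (+ zero)  = sym -0#≈0#
    -‿homo (+ suc n) = refl
    -‿homo -[1+ n ]  = sym (-‿involutive _)

  homomorphism : ℤ.+-*-rawRing -Raw-AlmostCommutative⟶ fromCommutativeRing R
  homomorphism = record
    { ⟦_⟧    = ⟦_⟧ℤ
    ; +-homo = +-homo
    ; *-homo = *-homo
    ; -‿homo = -‿homo
    ; 0-homo = refl
    ; 1-homo = +-identityʳ 1#
    }

  private
    weakly-≟ : ∀ i j → Maybe (⟦ i ⟧ℤ ≈ ⟦ j ⟧ℤ)
    weakly-≟ i j with i ℤ.≟ j
    ... | yes ≡.refl = just refl
    ... | no _       = nothing

  open import Algebra.Solver.Ring
    ℤ.+-*-rawRing (fromCommutativeRing R) homomorphism weakly-≟ public

module FieldProperties {c ℓ} (R : CommutativeRing c ℓ) (isField : IsField R) where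
  open CommutativeRing R
  open import Relation.Binary.Reasoning.Setoid setoid

  *-cancelˡ-≉0 : ∀ {x} s t → x ≉ 0# → x * s ≈ x * t → s ≈ t
  *-cancelˡ-≉0 {x} s t x≉0 xs≈xt = begin
    s             ≈⟨ y*[x*u]≈u s ⟨
    y * (x * s)   ≈⟨ *-congˡ xs≈xt ⟩
    y * (x * t)   ≈⟨ y*[x*u]≈u t ⟩
    t             ∎
    where
    y : Carrier
    y = proj₁ (proj₂ isField x x≉0)

    y*[x*u]≈u : ∀ u → y * (x * u) ≈ u
    y*[x*u]≈u u = begin
      y * (x * u) ≈⟨ *-assoc y x u ⟨
      (y * x) * u ≈⟨ *-congʳ (trans (*-comm y x) (proj₂ (proj₂ isField x x≉0))) ⟩
      1# * u      ≈⟨ *-identityˡ u ⟩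
      u           ∎

  *-≉0 : ∀ {x y} → x ≉ 0# → y ≉ 0# → x * y ≉ 0#
  *-≉0 {x} {y} x≉0 y≉0 xy≈0 =
    y≉0 (*-cancelˡ-≉0 y 0# x≉0 (trans xy≈0 (sym (zeroʳ x))))

module FourPoints {c ℓ} (R : CommutativeRing c ℓ) where
  open CommutativeRing R
  open Plane R
  open IntegerCoefficients R
  open import Data.Product using (_×_)
  open import Relation.Binary.Reasoning.Setoid setoid

  Π : Point → Point → Point → Point → Carrier
  Π p q r s = (det p q r * det p q s) * (det p r s * det q r s)

  private
    PointExpr : ℕ → Set _
    PointExpr n = Polynomial n × Polynomial n

    :det : ∀ {n} → PointExpr n → PointExpr n → PointExpr n → Polynomial n
    :det (x0 , y0) (x1 , y1) (x2 , y2) =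
      x0 :* (y1 :- y2) :- x1 :* (y0 :- y2) :+ x2 :* (y0 :- y1)

    :f : ∀ {n} → PointExpr n → PointExpr n → PointExpr n → PointExpr n → Polynomial n
    :f a b p q = :det a p q :* :det b p q

    :Π : ∀ {n} → PointExpr n → PointExpr n → PointExpr n → PointExpr n → Polynomial n
    :Π p q r s = (:det p q r :* :det p q s) :* (:det p r s :* :det q r s)

  Π-swap₁₂ : ∀ p q r s → Π p q r s ≈ Π q p r s
  Π-swap₁₂ (px , py) (qx , qy) (rx , ry) (sx , sy) =
    solve 8 (λ px py qx qy rx ry sx sy →
      let p = px , py; q = qx , qy; r = rx , ry; s = sx , sy
      in  :Π p q r s := :Π q p r s)
      refl px py qx qy rx ry sx sy

  Π-swap₂₃ : ∀ p q r s → Π p q r s ≈ Π p r q s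
  Π-swap₂₃ (px , py) (qx , qy) (rx , ry) (sx , sy) =
    solve 8 (λ px py qx qy rx ry sx sy →
      let p = px , py; q = qx , qy; r = rx , ry; s = sx , sy
      in  :Π p q r s := :Π p r q s)
      refl px py qx qy rx ry sx sy

  Π-swap₃₄ : ∀ p q r s → Π p q r s ≈ Π p q s r
  Π-swap₃₄ (px , py) (qx , qy) (rx , ry) (sx , sy) =
    solve 8 (λ px py qx qy rx ry sx sy →
      let p = px , py; q = qx , qy; r = rx , ry; s = sx , sy
      in  :Π p q r s := :Π p q s r)
      refl px py qx qy rx ry sx sy

  Π-expansion : ∀ a b p1 p2 p3 p4 →
    f p1 p2 p3 p4 * f a b p1 p2 + f p1 p3 p2 p4 * f a b p1 p3 + f p1 p4 p2 p3 * f a b p1 p4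
      + f p2 p3 p1 p4 * f a b p2 p3 + f p2 p4 p1 p3 * f a b p2 p4 + f p3 p4 p1 p2 * f a b p3 p4
    ≈ Π p1 p2 p3 p4
  Π-expansion (ax , ay) (bx , by) (x1 , y1) (x2 , y2) (x3 , y3) (x4 , y4) =
    solve 12 (λ ax ay bx by x1 y1 x2 y2 x3 y3 x4 y4 →
      let a = ax , ay; b = bx , by; p1 = x1 , y1; p2 = x2 , y2; p3 = x3 , y3; p4 = x4 , y4
      in  :f p1 p2 p3 p4 :* :f a b p1 p2 :+ :f p1 p3 p2 p4 :* :f a b p1 p3
            :+ :f p1 p4 p2 p3 :* :f a b p1 p4 :+ :f p2 p3 p1 p4 :* :f a b p2 p3
            :+ :f p2 p4 p1 p3 :* :f a b p2 p4 :+ :f p3 p4 p1 p2 :* :f a b p3 p4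
          := :Π p1 p2 p3 p4)
      refl ax ay bx by x1 y1 x2 y2 x3 y3 x4 y4

  IsWeight⇒*Π≈f : ∀ {w p q r s} → IsWeight w p q r s → w * Π p q r s ≈ f p q r s
  IsWeight⇒*Π≈f {w} {p} {q} {r} {s} isWeight = begin
    w * Π p q r s                                 ≈⟨ *-assoc w _ _ ⟨
    (w * (det p q r * det p q s)) * f p q r s     ≈⟨ *-congʳ isWeight ⟩
    1# * f p q r s                                ≈⟨ *-identityˡ _ ⟩
    f p q r s                                     ∎

  Π-≉0 : IsField R → ∀ {p q r s} → GeneralPosition4 p q r s → Π p q r s ≉ 0#
  Π-≉0 isField (pqr , pqs , prs , qrs) = *-≉0 (*-≉0 pqr pqs) (*-≉0 prs qrs)
    where open FieldProperties R isField

lemma3p10 : ∀ {c ℓ} (R : CommutativeRing c ℓ) → IsField R →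
    let open CommutativeRing R
        open Plane R
    in (a b p1 p2 p3 p4 : Point) → GeneralPosition4 p1 p2 p3 p4 →
       (w12 w13 w14 w23 w24 w34 : Carrier) →
       IsWeight w12 p1 p2 p3 p4 → IsWeight w13 p1 p3 p2 p4 →
       IsWeight w14 p1 p4 p2 p3 → IsWeight w23 p2 p3 p1 p4 →
       IsWeight w24 p2 p4 p1 p3 → IsWeight w34 p3 p4 p1 p2 →
       w12 * f a b p1 p2 + w13 * f a b p1 p3 + w14 * f a b p1 p4
         + w23 * f a b p2 p3 + w24 * f a b p2 p4 + w34 * f a b p3 p4 ≈ 1#
lemma3p10 R isField a b p1 p2 p3 p4 gp w12 w13 w14 w23 w24 w34 h12 h13 h14 h23 h24 h34 =
  *-cancelˡ-≉0 _ _ (Π-≉0 isField gp) (begin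
    M * (w12 * f a b p1 p2 + w13 * f a b p1 p3 + w14 * f a b p1 p4
           + w23 * f a b p2 p3 + w24 * f a b p2 p4 + w34 * f a b p3 p4)
      ≈⟨ distribute M w12 w13 w14 w23 w24 w34 _ _ _ _ _ _ ⟩
    (w12 * M) * f a b p1 p2 + (w13 * M) * f a b p1 p3 + (w14 * M) * f a b p1 p4
      + (w23 * M) * f a b p2 p3 + (w24 * M) * f a b p2 p4 + (w34 * M) * f a b p3 p4
      ≈⟨ +-cong (+-cong (+-cong (+-cong (+-cong
           (scaled h12 refl) (scaled h13 Π₁₃₂₄)) (scaled h14 Π₁₄₂₃))
           (scaled h23 Π₂₃₁₄)) (scaled h24 Π₂₄₁₃)) (scaled h34 Π₃₄₁₂) ⟩
    f p1 p2 p3 p4 * f a b p1 p2 + f p1 p3 p2 p4 * f a b p1 p3 + f p1 p4 p2 p3 * f a b p1 p4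
      + f p2 p3 p1 p4 * f a b p2 p3 + f p2 p4 p1 p3 * f a b p2 p4 + f p3 p4 p1 p2 * f a b p3 p4
      ≈⟨ Π-expansion a b p1 p2 p3 p4 ⟩
    M
      ≈⟨ *-identityʳ M ⟨
    M * 1#
      ∎)
  where
  open CommutativeRing R
  open Plane R
  open FourPoints R
  open FieldProperties R isField
  open IntegerCoefficients R using (solve; _:=_; _:+_; _:*_)
  open import Relation.Binary.Reasoning.Setoid setoid

  M : Carrier
  M = Π p1 p2 p3 p4

  scaled : ∀ {w p q r s x} → IsWeight w p q r s → Π p q r s ≈ M → (w * M) * x ≈ f p q r s * x
  scaled isWeight Π≈M = *-congʳ (trans (*-congˡ (sym Π≈M)) (IsWeight⇒*Π≈f isWeight))

  Π₁₃₂₄ : Π p1 p3 p2 p4 ≈ M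
  Π₁₃₂₄ = Π-swap₂₃ p1 p3 p2 p4

  Π₁₄₂₃ : Π p1 p4 p2 p3 ≈ M
  Π₁₄₂₃ = trans (Π-swap₂₃ p1 p4 p2 p3) (Π-swap₃₄ p1 p2 p4 p3)

  Π₂₃₁₄ : Π p2 p3 p1 p4 ≈ M
  Π₂₃₁₄ = trans (Π-swap₂₃ p2 p3 p1 p4) (Π-swap₁₂ p2 p1 p3 p4)

  Π₂₄₁₃ : Π p2 p4 p1 p3 ≈ M
  Π₂₄₁₃ = trans (Π-swap₂₃ p2 p4 p1 p3) (trans (Π-swap₁₂ p2 p1 p4 p3) (Π-swap₃₄ p1 p2 p4 p3))

  Π₃₄₁₂ : Π p3 p4 p1 p2 ≈ M
  Π₃₄₁₂ = trans (Π-swap₂₃ p3 p4 p1 p2) (trans (Π-swap₁₂ p3 p1 p4 p2) (trans (Π-swap₃₄ p1 p3 p4 p2) Π₁₃₂₄))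

  distribute : ∀ m u₁ u₂ u₃ u₄ u₅ u₆ x₁ x₂ x₃ x₄ x₅ x₆ →
    m * (u₁ * x₁ + u₂ * x₂ + u₃ * x₃ + u₄ * x₄ + u₅ * x₅ + u₆ * x₆)
      ≈ (u₁ * m) * x₁ + (u₂ * m) * x₂ + (u₃ * m) * x₃
          + (u₄ * m) * x₄ + (u₅ * m) * x₅ + (u₆ * m) * x₆
  distribute = solve 13 (λ m u₁ u₂ u₃ u₄ u₅ u₆ x₁ x₂ x₃ x₄ x₅ x₆ →
    m :* (u₁ :* x₁ :+ u₂ :* x₂ :+ u₃ :* x₃ :+ u₄ :* x₄ :+ u₅ :* x₅ :+ u₆ :* x₆)
      := (u₁ :* m) :* x₁ :+ (u₂ :* m) :* x₂ :+ (u₃ :* m) :* x₃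
           :+ (u₄ :* m) :* x₄ :+ (u₅ :* m) :* x₅ :+ (u₆ :* m) :* x₆) refl
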